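{- Let $a_1,\dots,a_d\in\mathbb Z$ with $\sum_{i=1}^d a_i$ even, and let $s_{1,2}=\sum_{1\le i\le d,\ i\text{ odd}}a_i$, $s_{2,2}=\sum_{1\le i\le d,\ i\text{ even}}a_i$. Let $(x_n)_{n\ge1}$ be a real sequence satisfying $x_n=a_1x_{n-1}+\dots+a_dx_{n-d}$ for all $n>d$, and suppose that for $i=1,\dots,d$, $$x_i=\begin{cases}\frac{s_{1,2}-s_{2,2}}{2(s_{1,2}-s_{2,2}+1)}, & i \text{ odd},\\ \frac{s_{1,2}-s_{2,2}+2}{2(s_{1,2}-s_{2,2}+1)}, & i\text{ even}.\end{cases}$$ Then $(x_n)$ is periodic modulo $1$ with period of length $2$, i.e. $\{x_{n+2}\}=\{x_n\}$ for all $n\ge1$.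
   Context: $\{x\}$ denotes the fractional part of $x$. A sequence $(x_n)$ is periodic modulo 1 with period length $t$ if $\{x_n\}=\{x_{n+t}\}$ for all $n\in\mathbb N$ (the period need not be minimal).
   Formalization: The sequence $(x_n)$ takes values in ℚ instead of the reals. -}

module Defs where

open import Data.Nat using (ℕ; zero; suc)
open import Data.Fin using (Fin; toℕ)
open import Data.Bool using (Bool; true; false; if_then_else_)
open import Data.Integer as ℤ using (ℤ)
open import Data.Rational as ℚ using (ℚ; floor; _/_)

-- Fractional part {x} = x - ⌊x⌋ (as in the paper; note the stdlib's
-- fracPart uses truncation, which differs for negative numbers).
frac : ℚ → ℚ
frac q = q ℚ.- (floor q / 1)

sumFin : ∀ {d} → (Fin d → ℤ) → ℤ
sumFin {zero} f = ℤ.0ℤ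
sumFin {suc d} f = f Data.Fin.zero ℤ.+ sumFin (λ i → f (Data.Fin.suc i))

sumFinℚ : ∀ {d} → (Fin d → ℚ) → ℚ
sumFinℚ {zero} f = ℚ.0ℚ
sumFinℚ {suc d} f = f Data.Fin.zero ℚ.+ sumFinℚ (λ i → f (Data.Fin.suc i))

isOdd : ℕ → Bool
isOdd zero = false
isOdd (suc n) = if isOdd n then false else true

-- Coefficients a_1,…,a_d are given as a : Fin d → ℤ with a i = a_{toℕ i + 1}.
-- s₁₂ = sum of a_i over odd i (1-based), i.e. toℕ i even.
s12 : ∀ {d} → (Fin d → ℤ) → ℤ
s12 a = sumFin (λ i → if isOdd (suc (toℕ i)) then a i else ℤ.0ℤ)

s22 : ∀ {d} → (Fin d → ℤ) → ℤ
s22 a = sumFin (λ i → if isOdd (suc (toℕ i)) then ℤ.0ℤ else a i)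

recRHS : ∀ {d} → (Fin d → ℤ) → (ℕ → ℚ) → ℕ → ℚ
recRHS a x n = sumFinℚ (λ i → (a i / 1) ℚ.* x (n Data.Nat.∸ suc (toℕ i)))

module Submission where

-- Put s = s₁₂ - s₂₂, D = 2(s + 1), α = s/D, β = (s + 2)/D and let
-- y be the 2-periodic sequence with y_n = α for odd n and y_n = β for even n;
-- the hypothesis on the initial values says x_i = y_i for 1 ≤ i ≤ d.  The
-- sequence y does not satisfy the recurrence, but it does so modulo ℤ: each
-- y_{n-i} only depends on the parity of n - i, so the right-hand side of the
-- recurrence collapses to s₁₂·y_{n-1} + s₂₂·y_{n-2}, and writing
-- s₁₂ + s₂₂ = 2m this equals y_n + m (n odd) or y_n + m - 1 (n even).  A
-- recurrence with integer coefficients transports the relation "differs by an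
-- integer", so by strong induction x_n - y_n ∈ ℤ for all n ≥ 1.  Since the
-- fractional part is invariant under integer shifts,
-- {x_{n+2}} = {y_{n+2}} = {y_n} = {x_n}.

open import Defs
open import Data.Nat using (ℕ; zero; suc; _+_; _*_; _∸_; _≤_; _<_; _≤?_; s≤s; z≤n)
open import Data.Nat.Properties using (*-identityʳ; m≤m+n; ≰⇒>; ≤-trans; ≤-<-trans; <⇒≤; ∸-monoʳ-<; m<n⇒0<n∸m; m+[n∸m]≡n)
open import Data.Nat.Induction using (<-rec)
open import Data.Fin using (Fin; toℕ)
open import Data.Fin.Properties using (toℕ<n)
open import Data.Bool using (Bool; true; false; not; _xor_; if_then_else_)
open import Data.Bool.Properties using (not-distribˡ-xor; xor-identityʳ)
open import Data.Integer as ℤ using (ℤ; +_; +[1+_])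
import Data.Integer.Properties as ℤP
import Data.Integer.DivMod as ℤD
open import Data.Integer.Divisibility using (_∣_)
import Data.Integer.Divisibility.Signed as Signed
open import Data.Rational as ℚ using (ℚ; mkℚ; _/_; _÷_)
import Data.Rational.Properties as ℚP
import Data.Rational.Unnormalised as ℚᵘ
import Data.Rational.Unnormalised.Properties as ℚᵘP
open import Relation.Nullary using (yes; no)
open import Relation.Binary.PropositionalEquality
  using (_≡_; refl; sym; trans; cong; cong₂; subst; subst₂; module ≡-Reasoning)
import Data.Integer.Solver as ℤSolver
import Data.Rational.Solver as ℚSolver

ℤ→ℚ-+ : ∀ i j → (i ℤ.+ j) / 1 ≡ i / 1 ℚ.+ j / 1
ℤ→ℚ-+ i j = ℚP.toℚᵘ-injective (begin
  ℚ.toℚᵘ ((i ℤ.+ j) / 1)                ≈⟨ ℚP.toℚᵘ-fromℚᵘ (ℚᵘ.mkℚᵘ (i ℤ.+ j) 0) ⟩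
  ℚᵘ.mkℚᵘ (i ℤ.+ j) 0                   ≈⟨ ℚᵘ.*≡* unit-denominators ⟩
  ℚᵘ.mkℚᵘ i 0 ℚᵘ.+ ℚᵘ.mkℚᵘ j 0          ≈⟨ ℚᵘP.+-cong (ℚP.toℚᵘ-fromℚᵘ (ℚᵘ.mkℚᵘ i 0))
                                                      (ℚP.toℚᵘ-fromℚᵘ (ℚᵘ.mkℚᵘ j 0)) ⟨
  ℚ.toℚᵘ (i / 1) ℚᵘ.+ ℚ.toℚᵘ (j / 1)    ≈⟨ ℚP.toℚᵘ-homo-+ (i / 1) (j / 1) ⟨
  ℚ.toℚᵘ (i / 1 ℚ.+ j / 1)              ∎)
  where
  open ℚᵘP.≃-Reasoning
  unit-denominators : (i ℤ.+ j) ℤ.* + 1 ≡ (i ℤ.* + 1 ℤ.+ j ℤ.* + 1) ℤ.* + 1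
  unit-denominators rewrite ℤP.*-identityʳ i | ℤP.*-identityʳ j = refl

ℤ→ℚ-* : ∀ i j → (i ℤ.* j) / 1 ≡ (i / 1) ℚ.* (j / 1)
ℤ→ℚ-* i j = ℚP.toℚᵘ-injective (begin
  ℚ.toℚᵘ ((i ℤ.* j) / 1)                ≈⟨ ℚP.toℚᵘ-fromℚᵘ (ℚᵘ.mkℚᵘ (i ℤ.* j) 0) ⟩
  ℚᵘ.mkℚᵘ (i ℤ.* j) 0                   ≈⟨ ℚᵘP.*-cong (ℚP.toℚᵘ-fromℚᵘ (ℚᵘ.mkℚᵘ i 0))
                                                      (ℚP.toℚᵘ-fromℚᵘ (ℚᵘ.mkℚᵘ j 0)) ⟨
  ℚ.toℚᵘ (i / 1) ℚᵘ.* ℚ.toℚᵘ (j / 1)    ≈⟨ ℚP.toℚᵘ-homo-* (i / 1) (j / 1) ⟨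
  ℚ.toℚᵘ ((i / 1) ℚ.* (j / 1))          ∎)
  where open ℚᵘP.≃-Reasoning

record IsFloor (D n f : ℤ) : Set where
  constructor _,_
  field
    below : f ℤ.* D ℤ.≤ n
    above : n ℤ.< ℤ.suc f ℤ.* D

isFloor-unique : ∀ d {n f g} → IsFloor +[1+ d ] n f → IsFloor +[1+ d ] n g → f ≡ g
isFloor-unique d {n} {f} {g} (f-lo , f-hi) (g-lo , g-hi) =
  ℤP.≤-antisym (below-next {n} {f} {g} g-hi f-lo) (below-next {n} {g} {f} f-hi g-lo)
  where
  below-next : ∀ {n a b} → n ℤ.< ℤ.suc b ℤ.* +[1+ d ] → a ℤ.* +[1+ d ] ℤ.≤ n → a ℤ.≤ b
  below-next {n} {a} {b} hi lo = subst (a ℤ.≤_) (ℤP.pred-suc b)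
    (ℤP.i<j⇒i≤pred[j] {a} {ℤ.suc b} (ℤP.*-cancelʳ-<-nonNeg +[1+ d ] (ℤP.≤-<-trans lo hi)))

isFloor-floor : ∀ p → IsFloor (ℚ.↧ p) (ℚ.↥ p) (ℚ.floor p)
isFloor-floor (mkℚ n d _) = lo , hi
  where
  D = +[1+ d ]
  f = n ℤD./ D
  division : n ≡ + (n ℤD.% D) ℤ.+ f ℤ.* D
  division = ℤD.a≡a%n+[a/n]*n n D
  lo : f ℤ.* D ℤ.≤ n
  lo = subst (f ℤ.* D ℤ.≤_) (sym division) (ℤP.i≤j+i (f ℤ.* D) (+ (n ℤD.% D)))
  suc-f : ℤ.suc f ℤ.* D ≡ D ℤ.+ f ℤ.* D
  suc-f = trans (ℤP.*-distribʳ-+ D (+ 1) f) (cong (ℤ._+ f ℤ.* D) (ℤP.*-identityˡ D))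
  hi : n ℤ.< ℤ.suc f ℤ.* D
  hi = subst₂ ℤ._<_ (sym division) (sym suc-f)
         (ℤP.+-monoˡ-< (f ℤ.* D) (ℤ.+<+ (ℤD.n%d<d n D)))

isFloor-rescale : ∀ {d d' n n' f} → IsFloor +[1+ d ] n f →
                  n' ℤ.* +[1+ d ] ≡ n ℤ.* +[1+ d' ] → IsFloor +[1+ d' ] n' f
isFloor-rescale {d} {d'} {n} {n'} {f} (lo , hi) cross = lo' , hi'
  where
  D = +[1+ d ]
  D' = +[1+ d' ]
  swap : ∀ c → c ℤ.* D ℤ.* D' ≡ c ℤ.* D' ℤ.* D
  swap c = trans (ℤP.*-assoc c D D') (trans (cong (c ℤ.*_) (ℤP.*-comm D D')) (sym (ℤP.*-assoc c D' D)))
  lo' : f ℤ.* D' ℤ.≤ n'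
  lo' = ℤP.*-cancelʳ-≤-pos _ _ D
          (subst₂ ℤ._≤_ (swap f) (sym cross) (ℤP.*-monoʳ-≤-nonNeg D' lo))
  hi' : n' ℤ.< ℤ.suc f ℤ.* D'
  hi' = ℤP.*-cancelʳ-<-nonNeg D
          (subst₂ ℤ._<_ (sym cross) (swap (ℤ.suc f)) (ℤP.*-monoʳ-<-pos D' hi))

isFloor-shift : ∀ {D n f} k → IsFloor D n f → IsFloor D (n ℤ.+ k ℤ.* D) (f ℤ.+ k)
isFloor-shift {D} {n} {f} k (lo , hi) =
  subst (ℤ._≤ n ℤ.+ k ℤ.* D) (sym (ℤP.*-distribʳ-+ D f k)) (ℤP.+-monoˡ-≤ (k ℤ.* D) lo) ,
  subst (n ℤ.+ k ℤ.* D ℤ.<_) (sym suc-distrib) (ℤP.+-monoˡ-< (k ℤ.* D) hi)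
  where
  open ℤSolver.+-*-Solver
  suc-distrib : ℤ.suc (f ℤ.+ k) ℤ.* D ≡ ℤ.suc f ℤ.* D ℤ.+ k ℤ.* D
  suc-distrib = solve 3 (λ f k D → (con (+ 1) :+ (f :+ k)) :* D := (con (+ 1) :+ f) :* D :+ k :* D)
                  refl f k D

floor-represented : ∀ q {n d f} → ℚ.toℚᵘ q ℚᵘ.≃ ℚᵘ.mkℚᵘ n d → IsFloor +[1+ d ] n f → ℚ.floor q ≡ f
floor-represented q@(mkℚ _ d' _) (ℚᵘ.*≡* cross) isFloor =
  isFloor-unique d' (isFloor-floor q) (isFloor-rescale isFloor cross)

toℚᵘ-+ℤ : ∀ p k → ℚ.toℚᵘ (p ℚ.+ k / 1) ℚᵘ.≃ ℚᵘ.mkℚᵘ (ℚ.↥ p ℤ.+ k ℤ.* ℚ.↧ p) (ℚ.ℚ.denominator-1 p)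
toℚᵘ-+ℤ p@(mkℚ n d _) k = begin
  ℚ.toℚᵘ (p ℚ.+ k / 1)                     ≈⟨ ℚP.toℚᵘ-homo-+ p (k / 1) ⟩
  ℚ.toℚᵘ p ℚᵘ.+ ℚ.toℚᵘ (k / 1)             ≈⟨ ℚᵘP.+-congʳ (ℚ.toℚᵘ p) (ℚP.toℚᵘ-fromℚᵘ (ℚᵘ.mkℚᵘ k 0)) ⟩
  ℚ.toℚᵘ p ℚᵘ.+ ℚᵘ.mkℚᵘ k 0                ≈⟨ ℚᵘ.*≡* cross ⟩
  ℚᵘ.mkℚᵘ (n ℤ.+ k ℤ.* +[1+ d ]) d         ∎
  where
  open ℚᵘP.≃-Reasoning
  cross : (n ℤ.* + 1 ℤ.+ k ℤ.* +[1+ d ]) ℤ.* +[1+ d ] ≡ (n ℤ.+ k ℤ.* +[1+ d ]) ℤ.* +[1+ d * 1 ]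
  cross rewrite *-identityʳ d | ℤP.*-identityʳ n = refl

floor-+ℤ : ∀ p k → ℚ.floor (p ℚ.+ k / 1) ≡ ℚ.floor p ℤ.+ k
floor-+ℤ p k = floor-represented (p ℚ.+ k / 1) (toℚᵘ-+ℤ p k) (isFloor-shift k (isFloor-floor p))

frac-+ℤ : ∀ p k → frac (p ℚ.+ k / 1) ≡ frac p
frac-+ℤ p k rewrite floor-+ℤ p k | ℤ→ℚ-+ (ℚ.floor p) k =
  solve 3 (λ p k f → (p :+ k) :- (f :+ k) := p :- f) refl p (k / 1) (ℚ.floor p / 1)
  where open ℚSolver.+-*-Solver

infix 4 _≡ᶻ_
record _≡ᶻ_ (p q : ℚ) : Set where
  constructor differ-by
  field
    difference : ℤ
    shifted    : p ≡ q ℚ.+ difference / 1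

≡ᶻ-reflexive : ∀ {p q} → p ≡ q → p ≡ᶻ q
≡ᶻ-reflexive {q = q} refl = differ-by ℤ.0ℤ (sym (ℚP.+-identityʳ q))

≡ᶻ-trans : ∀ {p q r} → p ≡ᶻ q → q ≡ᶻ r → p ≡ᶻ r
≡ᶻ-trans {p} {q} {r} (differ-by k p≡q+k) (differ-by l q≡r+l) = differ-by (l ℤ.+ k) (begin
  p                            ≡⟨ p≡q+k ⟩
  q ℚ.+ k / 1                  ≡⟨ cong (ℚ._+ k / 1) q≡r+l ⟩
  r ℚ.+ l / 1 ℚ.+ k / 1        ≡⟨ ℚP.+-assoc r (l / 1) (k / 1) ⟩
  r ℚ.+ (l / 1 ℚ.+ k / 1)      ≡⟨ cong (r ℚ.+_) (ℤ→ℚ-+ l k) ⟨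
  r ℚ.+ (l ℤ.+ k) / 1          ∎)
  where open ≡-Reasoning

≡ᶻ-+ : ∀ {p p' q q'} → p ≡ᶻ q → p' ≡ᶻ q' → p ℚ.+ p' ≡ᶻ q ℚ.+ q'
≡ᶻ-+ {q = q} {q'} (differ-by k refl) (differ-by k' refl) = differ-by (k ℤ.+ k') (begin
  q ℚ.+ k / 1 ℚ.+ (q' ℚ.+ k' / 1)   ≡⟨ solve 4 (λ q k q' k' → q :+ k :+ (q' :+ k') := q :+ q' :+ (k :+ k'))
                                              refl q (k / 1) q' (k' / 1) ⟩
  q ℚ.+ q' ℚ.+ (k / 1 ℚ.+ k' / 1)   ≡⟨ cong (q ℚ.+ q' ℚ.+_) (ℤ→ℚ-+ k k') ⟨
  q ℚ.+ q' ℚ.+ (k ℤ.+ k') / 1       ∎)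
  where open ≡-Reasoning; open ℚSolver.+-*-Solver

≡ᶻ-scale : ∀ c {p q} → p ≡ᶻ q → (c / 1) ℚ.* p ≡ᶻ (c / 1) ℚ.* q
≡ᶻ-scale c {q = q} (differ-by k refl) = differ-by (c ℤ.* k) (begin
  (c / 1) ℚ.* (q ℚ.+ k / 1)                  ≡⟨ ℚP.*-distribˡ-+ (c / 1) q (k / 1) ⟩
  (c / 1) ℚ.* q ℚ.+ (c / 1) ℚ.* (k / 1)      ≡⟨ cong ((c / 1) ℚ.* q ℚ.+_) (ℤ→ℚ-* c k) ⟨
  (c / 1) ℚ.* q ℚ.+ (c ℤ.* k) / 1            ∎)
  where open ≡-Reasoning

frac-cong : ∀ {p q} → p ≡ᶻ q → frac p ≡ frac q
frac-cong {q = q} (differ-by k refl) = frac-+ℤ q k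

sumFin-cong : ∀ {d} {f g : Fin d → ℤ} → (∀ i → f i ≡ g i) → sumFin f ≡ sumFin g
sumFin-cong {zero} f≡g = refl
sumFin-cong {suc d} f≡g = cong₂ ℤ._+_ (f≡g Data.Fin.zero) (sumFin-cong (λ i → f≡g (Data.Fin.suc i)))

sumFin-+ : ∀ {d} (f g : Fin d → ℤ) → sumFin (λ i → f i ℤ.+ g i) ≡ sumFin f ℤ.+ sumFin g
sumFin-+ {zero} f g = refl
sumFin-+ {suc d} f g
  rewrite sumFin-+ (λ i → f (Data.Fin.suc i)) (λ i → g (Data.Fin.suc i)) =
  solve 4 (λ a b F G → a :+ b :+ (F :+ G) := a :+ F :+ (b :+ G)) refl
    (f Data.Fin.zero) (g Data.Fin.zero) (sumFin (λ i → f (Data.Fin.suc i))) (sumFin (λ i → g (Data.Fin.suc i)))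
  where open ℤSolver.+-*-Solver

sumFinℚ-cong : ∀ {d} {f g : Fin d → ℚ} → (∀ i → f i ≡ g i) → sumFinℚ f ≡ sumFinℚ g
sumFinℚ-cong {zero} f≡g = refl
sumFinℚ-cong {suc d} f≡g = cong₂ ℚ._+_ (f≡g Data.Fin.zero) (sumFinℚ-cong (λ i → f≡g (Data.Fin.suc i)))

sumFinℚ-+ : ∀ {d} (f g : Fin d → ℚ) → sumFinℚ (λ i → f i ℚ.+ g i) ≡ sumFinℚ f ℚ.+ sumFinℚ g
sumFinℚ-+ {zero} f g = sym (ℚP.+-identityʳ ℚ.0ℚ)
sumFinℚ-+ {suc d} f g
  rewrite sumFinℚ-+ (λ i → f (Data.Fin.suc i)) (λ i → g (Data.Fin.suc i)) =
  solve 4 (λ a b F G → a :+ b :+ (F :+ G) := a :+ F :+ (b :+ G)) refl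
    (f Data.Fin.zero) (g Data.Fin.zero) (sumFinℚ (λ i → f (Data.Fin.suc i))) (sumFinℚ (λ i → g (Data.Fin.suc i)))
  where open ℚSolver.+-*-Solver

sumFinℚ-factor : ∀ {d} (c : Fin d → ℤ) P → sumFinℚ (λ i → (c i / 1) ℚ.* P) ≡ (sumFin c / 1) ℚ.* P
sumFinℚ-factor {zero} c P = sym (ℚP.*-zeroˡ P)
sumFinℚ-factor {suc d} c P = begin
  (c₀ / 1) ℚ.* P ℚ.+ sumFinℚ (λ i → (c (Data.Fin.suc i) / 1) ℚ.* P)
    ≡⟨ cong ((c₀ / 1) ℚ.* P ℚ.+_) (sumFinℚ-factor (λ i → c (Data.Fin.suc i)) P) ⟩
  (c₀ / 1) ℚ.* P ℚ.+ (C / 1) ℚ.* P   ≡⟨ ℚP.*-distribʳ-+ P (c₀ / 1) (C / 1) ⟨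
  (c₀ / 1 ℚ.+ C / 1) ℚ.* P           ≡⟨ cong (ℚ._* P) (ℤ→ℚ-+ c₀ C) ⟨
  ((c₀ ℤ.+ C) / 1) ℚ.* P             ∎
  where
  open ≡-Reasoning
  c₀ = c Data.Fin.zero
  C = sumFin (λ i → c (Data.Fin.suc i))

sumFinℚ-≡ᶻ : ∀ {d} {f g : Fin d → ℚ} → (∀ i → f i ≡ᶻ g i) → sumFinℚ f ≡ᶻ sumFinℚ g
sumFinℚ-≡ᶻ {zero} f≡ᶻg = ≡ᶻ-reflexive refl
sumFinℚ-≡ᶻ {suc d} f≡ᶻg = ≡ᶻ-+ (f≡ᶻg Data.Fin.zero) (sumFinℚ-≡ᶻ (λ i → f≡ᶻg (Data.Fin.suc i)))

sumFin-split : ∀ {d} (p : Fin d → Bool) (a : Fin d → ℤ) →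
  sumFin (λ i → if p i then a i else ℤ.0ℤ) ℤ.+ sumFin (λ i → if p i then ℤ.0ℤ else a i) ≡ sumFin a
sumFin-split p a = trans (sym (sumFin-+ (λ i → if p i then a i else ℤ.0ℤ) (λ i → if p i then ℤ.0ℤ else a i))) (sumFin-cong (λ i → select (p i) (a i)))
  where
  select : ∀ b c → (if b then c else ℤ.0ℤ) ℤ.+ (if b then ℤ.0ℤ else c) ≡ c
  select true c = ℤP.+-identityʳ c
  select false c = ℤP.+-identityˡ c

recurrence-≡ᶻ : ∀ {d} (a : Fin d → ℤ) (x y : ℕ → ℚ) →
  (∀ n → d < n → x n ≡ recRHS a x n) →
  (∀ n → d < n → recRHS a y n ≡ᶻ y n) →
  (∀ i → 1 ≤ i → i ≤ d → x i ≡ᶻ y i) →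
  ∀ n → 1 ≤ n → x n ≡ᶻ y n
recurrence-≡ᶻ {d} a x y x-rec y-rec initial = <-rec (λ n → 1 ≤ n → x n ≡ᶻ y n) step
  where
  step : ∀ n → (∀ {m} → m < n → 1 ≤ m → x m ≡ᶻ y m) → 1 ≤ n → x n ≡ᶻ y n
  step n earlier 1≤n with n ≤? d
  ... | yes n≤d = initial n 1≤n n≤d
  ... | no n≰d = subst (_≡ᶻ y n) (sym (x-rec n d<n))
                   (≡ᶻ-trans (sumFinℚ-≡ᶻ (λ i → ≡ᶻ-scale (a i) (lagged i))) (y-rec n d<n))
    where
    d<n : d < n
    d<n = ≰⇒> n≰d
    lagged : ∀ i → x (n ∸ suc (toℕ i)) ≡ᶻ y (n ∸ suc (toℕ i))
    lagged i = earlier (∸-monoʳ-< (s≤s z≤n) (<⇒≤ i+1<n)) (m<n⇒0<n∸m i+1<n)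
      where
      i+1<n : suc (toℕ i) < n
      i+1<n = ≤-<-trans (toℕ<n i) d<n

isOdd-suc : ∀ n → isOdd (suc n) ≡ not (isOdd n)
isOdd-suc n with isOdd n
... | true = refl
... | false = refl

isOdd-+ : ∀ m n → isOdd (m + n) ≡ isOdd m xor isOdd n
isOdd-+ zero n = refl
isOdd-+ (suc m) n = begin
  isOdd (suc (m + n))            ≡⟨ isOdd-suc (m + n) ⟩
  not (isOdd (m + n))            ≡⟨ cong not (isOdd-+ m n) ⟩
  not (isOdd m xor isOdd n)      ≡⟨ not-distribˡ-xor (isOdd m) (isOdd n) ⟩
  not (isOdd m) xor isOdd n      ≡⟨ cong (_xor isOdd n) (isOdd-suc m) ⟨
  isOdd (suc m) xor isOdd n      ∎
  where open ≡-Reasoning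

alternating : ℚ → ℚ → ℕ → ℚ
alternating p q n = if isOdd n then p else q

alternating-+2 : ∀ p q n → alternating p q (n + 2) ≡ alternating p q n
alternating-+2 p q n =
  cong (λ b → if b then p else q) (trans (isOdd-+ n 2) (xor-identityʳ (isOdd n)))

alternating-∸ : ∀ p q j n → j ≤ n →
  alternating p q (n ∸ j) ≡ (if isOdd j then alternating q p n else alternating p q n)
alternating-∸ p q j n j≤n = begin
  alternating p q (n ∸ j)
    ≡⟨ by-phase (isOdd j) (isOdd (n ∸ j)) ⟩
  (if isOdd j then (if isOdd j xor isOdd (n ∸ j) then q else p)
              else (if isOdd j xor isOdd (n ∸ j) then p else q))
    ≡⟨ cong (λ b → if isOdd j then (if b then q else p) else (if b then p else q)) parity-n ⟩
  (if isOdd j then alternating q p n else alternating p q n) ∎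
  where
  open ≡-Reasoning
  parity-n : isOdd j xor isOdd (n ∸ j) ≡ isOdd n
  parity-n = trans (sym (isOdd-+ j (n ∸ j))) (cong isOdd (m+[n∸m]≡n j≤n))
  by-phase : ∀ b c → (if c then p else q) ≡
             (if b then (if b xor c then q else p) else (if b xor c then p else q))
  by-phase true true = refl
  by-phase true false = refl
  by-phase false true = refl
  by-phase false false = refl

-- Along an alternating sequence the recurrence only sees the parity of each lag,
-- so its right-hand side is s₁₂ times the previous term plus s₂₂ times the one before.
recRHS-alternating : ∀ {d} (a : Fin d → ℤ) p q n → d < n →
  recRHS a (alternating p q) n ≡ (s12 a / 1) ℚ.* alternating q p n ℚ.+ (s22 a / 1) ℚ.* alternating p q n
recRHS-alternating a p q n d<n = begin
  recRHS a (alternating p q) n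
    ≡⟨ sumFinℚ-cong (λ i → cong ((a i / 1) ℚ.*_) (alternating-∸ p q (suc (toℕ i)) n (lag≤n i))) ⟩
  sumFinℚ (λ i → (a i / 1) ℚ.* (if odd-lag i then P else Q))
    ≡⟨ sumFinℚ-cong (λ i → select (odd-lag i) (a i)) ⟩
  sumFinℚ (λ i → (odd-part i / 1) ℚ.* P ℚ.+ (even-part i / 1) ℚ.* Q)
    ≡⟨ sumFinℚ-+ (λ i → (odd-part i / 1) ℚ.* P) (λ i → (even-part i / 1) ℚ.* Q) ⟩
  sumFinℚ (λ i → (odd-part i / 1) ℚ.* P) ℚ.+ sumFinℚ (λ i → (even-part i / 1) ℚ.* Q)
    ≡⟨ cong₂ ℚ._+_ (sumFinℚ-factor odd-part P) (sumFinℚ-factor even-part Q) ⟩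
  (s12 a / 1) ℚ.* P ℚ.+ (s22 a / 1) ℚ.* Q ∎
  where
  open ≡-Reasoning
  P = alternating q p n
  Q = alternating p q n
  odd-lag : Fin _ → Bool
  odd-lag i = isOdd (suc (toℕ i))
  odd-part even-part : Fin _ → ℤ
  odd-part i = if odd-lag i then a i else ℤ.0ℤ
  even-part i = if odd-lag i then ℤ.0ℤ else a i
  lag≤n : ∀ i → suc (toℕ i) ≤ n
  lag≤n i = ≤-trans (toℕ<n i) (<⇒≤ d<n)
  select : ∀ b c → (c / 1) ℚ.* (if b then P else Q) ≡
           ((if b then c else ℤ.0ℤ) / 1) ℚ.* P ℚ.+ ((if b then ℤ.0ℤ else c) / 1) ℚ.* Q
  select true c = solve 3 (λ c P Q → c :* P := c :* P :+ con ℚ.0ℚ :* Q) refl (c / 1) P Q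
    where open ℚSolver.+-*-Solver
  select false c = solve 3 (λ c P Q → c :* Q := con ℚ.0ℚ :* P :+ c :* Q) refl (c / 1) P Q
    where open ℚSolver.+-*-Solver

scale-by-inverse : ∀ A B N₁ N₂ R m D (u : ℚ) →
  A ℤ.* N₁ ℤ.+ B ℤ.* N₂ ≡ R ℤ.+ m ℤ.* D → (D / 1) ℚ.* u ≡ ℚ.1ℚ →
  (A / 1) ℚ.* ((N₁ / 1) ℚ.* u) ℚ.+ (B / 1) ℚ.* ((N₂ / 1) ℚ.* u) ≡ (R / 1) ℚ.* u ℚ.+ m / 1
scale-by-inverse A B N₁ N₂ R m D u integral D*u≡1 = begin
  (A / 1) ℚ.* ((N₁ / 1) ℚ.* u) ℚ.+ (B / 1) ℚ.* ((N₂ / 1) ℚ.* u)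
    ≡⟨ solve 5 (λ A B N₁ N₂ u → A :* (N₁ :* u) :+ B :* (N₂ :* u) := (A :* N₁ :+ B :* N₂) :* u)
         refl (A / 1) (B / 1) (N₁ / 1) (N₂ / 1) u ⟩
  ((A / 1) ℚ.* (N₁ / 1) ℚ.+ (B / 1) ℚ.* (N₂ / 1)) ℚ.* u
    ≡⟨ cong (ℚ._* u) (trans (ℤ→ℚ-+ (A ℤ.* N₁) (B ℤ.* N₂)) (cong₂ ℚ._+_ (ℤ→ℚ-* A N₁) (ℤ→ℚ-* B N₂))) ⟨
  ((A ℤ.* N₁ ℤ.+ B ℤ.* N₂) / 1) ℚ.* u
    ≡⟨ cong (λ z → (z / 1) ℚ.* u) integral ⟩
  ((R ℤ.+ m ℤ.* D) / 1) ℚ.* u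
    ≡⟨ cong (ℚ._* u) (trans (ℤ→ℚ-+ R (m ℤ.* D)) (cong ((R / 1) ℚ.+_) (ℤ→ℚ-* m D))) ⟩
  ((R / 1) ℚ.+ (m / 1) ℚ.* (D / 1)) ℚ.* u
    ≡⟨ solve 4 (λ R m D u → (R :+ m :* D) :* u := R :* u :+ m :* (D :* u)) refl (R / 1) (m / 1) (D / 1) u ⟩
  (R / 1) ℚ.* u ℚ.+ (m / 1) ℚ.* ((D / 1) ℚ.* u)
    ≡⟨ cong (λ z → (R / 1) ℚ.* u ℚ.+ (m / 1) ℚ.* z) D*u≡1 ⟩
  (R / 1) ℚ.* u ℚ.+ (m / 1) ℚ.* ℚ.1ℚ
    ≡⟨ cong ((R / 1) ℚ.* u ℚ.+_) (ℚP.*-identityʳ (m / 1)) ⟩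
  (R / 1) ℚ.* u ℚ.+ m / 1 ∎
  where open ≡-Reasoning; open ℚSolver.+-*-Solver

-- The two integer identities behind the choice of α = s/D and β = (s+2)/D,
-- where s = A - B, D = 2(s + 1) and A + B = 2m:
--   A·(s+2) + B·s = s + m·D        and        A·s + B·(s+2) = (s+2) + (m-1)·D.
module _ (A B m : ℤ) (A+B≡2m : A ℤ.+ B ≡ m ℤ.* + 2) where
  open ℤSolver.+-*-Solver
  open ≡-Reasoning

  private
    s : ℤ
    s = A ℤ.- B

  odd-identity : A ℤ.* (s ℤ.+ + 2) ℤ.+ B ℤ.* s ≡ s ℤ.+ m ℤ.* (+ 2 ℤ.* (s ℤ.+ + 1))
  odd-identity = begin
    A ℤ.* (s ℤ.+ + 2) ℤ.+ B ℤ.* s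
      ≡⟨ solve 2 (λ A B → A :* (A :- B :+ con (+ 2)) :+ B :* (A :- B)
                       := (A :- B) :+ (A :+ B) :* (A :- B :+ con (+ 1))) refl A B ⟩
    s ℤ.+ (A ℤ.+ B) ℤ.* (s ℤ.+ + 1)
      ≡⟨ cong (λ t → s ℤ.+ t ℤ.* (s ℤ.+ + 1)) A+B≡2m ⟩
    s ℤ.+ m ℤ.* + 2 ℤ.* (s ℤ.+ + 1)
      ≡⟨ cong (λ t → s ℤ.+ t) (ℤP.*-assoc m (+ 2) (s ℤ.+ + 1)) ⟩
    s ℤ.+ m ℤ.* (+ 2 ℤ.* (s ℤ.+ + 1)) ∎

  even-identity : A ℤ.* s ℤ.+ B ℤ.* (s ℤ.+ + 2) ≡ (s ℤ.+ + 2) ℤ.+ (m ℤ.- + 1) ℤ.* (+ 2 ℤ.* (s ℤ.+ + 1))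
  even-identity = begin
    A ℤ.* s ℤ.+ B ℤ.* (s ℤ.+ + 2)
      ≡⟨ solve 2 (λ A B → A :* (A :- B) :+ B :* (A :- B :+ con (+ 2))
                       := (A :- B :+ con (+ 2)) :+ (A :+ B) :* (A :- B :+ con (+ 1))
                          :- con (+ 2) :* (A :- B :+ con (+ 1))) refl A B ⟩
    (s ℤ.+ + 2) ℤ.+ (A ℤ.+ B) ℤ.* (s ℤ.+ + 1) ℤ.- + 2 ℤ.* (s ℤ.+ + 1)
      ≡⟨ cong (λ t → (s ℤ.+ + 2) ℤ.+ t ℤ.* (s ℤ.+ + 1) ℤ.- + 2 ℤ.* (s ℤ.+ + 1)) A+B≡2m ⟩
    (s ℤ.+ + 2) ℤ.+ m ℤ.* + 2 ℤ.* (s ℤ.+ + 1) ℤ.- + 2 ℤ.* (s ℤ.+ + 1)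
      ≡⟨ solve 2 (λ m t → (t :+ con (+ 2)) :+ m :* con (+ 2) :* (t :+ con (+ 1)) :- con (+ 2) :* (t :+ con (+ 1))
                       := (t :+ con (+ 2)) :+ (m :- con (+ 1)) :* (con (+ 2) :* (t :+ con (+ 1)))) refl m s ⟩
    (s ℤ.+ + 2) ℤ.+ (m ℤ.- + 1) ℤ.* (+ 2 ℤ.* (s ℤ.+ + 1)) ∎

module AlternatingSolution {d} (a : Fin d → ℤ)
    (nz : ℚ.NonZero (((+ 2) ℤ.* (s12 a ℤ.- s22 a ℤ.+ + 1)) / 1)) where

  s D : ℤ
  s = s12 a ℤ.- s22 a
  D = + 2 ℤ.* (s ℤ.+ + 1)

  u α β : ℚ
  u = ℚ.1/_ (D / 1) {{nz}}
  α = (s / 1) ℚ.* u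
  β = ((s ℤ.+ + 2) / 1) ℚ.* u

  y : ℕ → ℚ
  y = alternating α β

  solves-mod-ℤ : + 2 ∣ sumFin a → ∀ n → d < n → recRHS a y n ≡ᶻ y n
  solves-mod-ℤ 2∣Σa n d<n =
    subst (_≡ᶻ y n) (sym (recRHS-alternating a α β n d<n)) (by-parity (isOdd n))
    where
    open Signed._∣_ (Signed.∣ᵤ⇒∣ {+ 2} {sumFin a} 2∣Σa) renaming (quotient to m; equality to Σa≡2m)
    s₁₂+s₂₂≡2m : s12 a ℤ.+ s22 a ≡ m ℤ.* + 2
    s₁₂+s₂₂≡2m = trans (sumFin-split (λ i → isOdd (suc (toℕ i))) a) Σa≡2m
    D*u≡1 : (D / 1) ℚ.* u ≡ ℚ.1ℚ
    D*u≡1 = ℚP.*-inverseʳ (D / 1) {{nz}}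
    by-parity : ∀ b → (s12 a / 1) ℚ.* (if b then β else α) ℚ.+ (s22 a / 1) ℚ.* (if b then α else β)
                      ≡ᶻ (if b then α else β)
    by-parity true = differ-by m
      (scale-by-inverse (s12 a) (s22 a) (s ℤ.+ + 2) s s m D u (odd-identity (s12 a) (s22 a) m s₁₂+s₂₂≡2m) D*u≡1)
    by-parity false = differ-by (m ℤ.- + 1)
      (scale-by-inverse (s12 a) (s22 a) s (s ℤ.+ + 2) (s ℤ.+ + 2) (m ℤ.- + 1) D u
        (even-identity (s12 a) (s22 a) m s₁₂+s₂₂≡2m) D*u≡1)

lemma3p3 : (d : ℕ) (a : Fin d → ℤ) → (ℤ.+ 2) ∣ sumFin a →
    (nz : ℚ.NonZero (((ℤ.+ 2) ℤ.* (s12 a ℤ.- s22 a ℤ.+ ℤ.+ 1)) / 1)) →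
    (x : ℕ → ℚ) →
    (∀ n → d < n → x n ≡ recRHS a x n) →
    (∀ i → 1 ≤ i → i ≤ d →
      x i ≡ (if isOdd i
               then _÷_ ((s12 a ℤ.- s22 a) / 1) (((ℤ.+ 2) ℤ.* (s12 a ℤ.- s22 a ℤ.+ ℤ.+ 1)) / 1) {{nz}}
               else _÷_ ((s12 a ℤ.- s22 a ℤ.+ ℤ.+ 2) / 1) (((ℤ.+ 2) ℤ.* (s12 a ℤ.- s22 a ℤ.+ ℤ.+ 1)) / 1) {{nz}})) →
    ∀ n → 1 ≤ n → frac (x (n + 2)) ≡ frac (x n)
lemma3p3 d a 2∣Σa nz x x-rec initial n 1≤n = begin
  frac (x (n + 2))   ≡⟨ frac-cong (x≡ᶻy (n + 2) (≤-trans 1≤n (m≤m+n n 2))) ⟩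
  frac (y (n + 2))   ≡⟨ cong frac (alternating-+2 α β n) ⟩
  frac (y n)         ≡⟨ frac-cong (x≡ᶻy n 1≤n) ⟨
  frac (x n)         ∎
  where
  open ≡-Reasoning
  open AlternatingSolution a nz
  x≡ᶻy : ∀ n → 1 ≤ n → x n ≡ᶻ y n
  x≡ᶻy = recurrence-≡ᶻ a x y x-rec (solves-mod-ℤ 2∣Σa) (λ i 1≤i i≤d → ≡ᶻ-reflexive (initial i 1≤i i≤d))
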